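{- For $n\ge 2$, $r,s\ge 1$ and $G\in \mathcal G_{2n}(2r+1,2s+1)$, $\chi_{la}(G) = 3$.
   Context: For a graph $G$, a bijection $f:E(G)\to[1,|E(G)|]$ is a local antimagic labeling if $f^+(u)\ne f^+(v)$ for every edge $uv$, where $f^+(u)$ is the sum of the labels of edges incident to $u$; $\chi_{la}(G)$ is the minimum number of distinct induced vertex labels over all local antimagic labelings. Let $2k+1=(2r+1)(2s+1)$, $n\ge 2$, $M=8k+4$, and consider $(2k+1)(P_2\vee O_{2n})$ with vertices $u_i,v_i,x_{i,j}$ and edges $u_iv_i,u_ix_{i,j},v_ix_{i,j}$ ($1\le i\le 2k+1$, $1\le j\le 2n$). Label edges bijectively with $[1,(4n+1)(2k+1)]$ as follows (with $2\le j\le n$ where $j$ appears). For $1\le i\le k+1$: $f(u_ix_{i,2n-2j+1})=k+2-i+jM$, $f(u_ix_{i,2n-2j+2})=-3k-2+i+jM$, $f(u_ix_{i,2n-1})=10k+7-2i$, $f(u_ix_{i,2n})=5k+2+i$, $f(u_iv_i)=i$, $f(v_ix_{i,1})=3k+1+i$, $f(v_ix_{i,2})=8k+6-2i$, $f(v_ix_{i,2j-1})=-5k-3+i+jM$, $f(v_ix_{i,2j})=-k+1-i+jM$. For $k+2\le i\le 2k+1$: $f(u_ix_{i,2n-2j+1})=3k+3-i+jM$, $f(u_ix_{i,2n-2j+2})=-5k-3+i+jM$, $f(u_ix_{i,2n-1})=12k+8-2i$, $f(u_ix_{i,2n})=3k+1+i$, $f(u_iv_i)=i$, $f(v_ix_{i,1})=k+i$,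 $f(v_ix_{i,2})=10k+7-2i$, $f(v_ix_{i,2j-1})=-7k-4+i+jM$, $f(v_ix_{i,2j})=k+2-i+jM$. Then $f^+(u_i)=8n^2k+6nk+4n^2+4n+k+1$, $f^+(v_i)=8n^2k+2nk+4n^2+2n+k+1$. For $j\in[1,2n]$ let $S_j=\{f^+(x_{i,j})\mid 1\le i\le 2k+1\}$: for $j=2,2n-1$ it is an arithmetic sequence from $5k+3+n(8k+4)$ to $3k+3+n(8k+4)$ with common difference $-1$, and for other $j$ every term equals $(4k+3)+n(8k+4)$; each $S_j$ has sum $(2k+1)[(4k+3)+n(8k+4)]$. Each $S_j$ can be partitioned (e.g. via a $(2r+1)\times(2s+1)$ magic rectangle in the non-constant case) into $2r+1$ blocks of size $2s+1$, each with sum $(2s+1)[(4k+3)+n(8k+4)]$; partitions for different $j$ may differ. $\mathcal G_{2n}(2r+1,2s+1)$ is the set of all graphs obtained by choosing such partitions for every $j$ and merging the vertices $x_{i,j}$ in each block into a single vertex of degree $2(2s+1)$. -}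

module Defs where

open import Data.Nat using (ℕ; zero; suc; _+_; _*_; _∸_; _≤_; _≤ᵇ_; _≡ᵇ_; ⌊_/2⌋)
import Data.Nat as ℕ
open import Data.Nat.DivMod using (_%_)
open import Data.Bool using (Bool; true; false; if_then_else_; _∨_)
open import Data.Fin as Fin using (Fin; toℕ; _↑ˡ_; _↑ʳ_; combine)
open import Data.Nat.ListAction using (sum)
open import Data.List using (List; []; _∷_; _++_; length; map; allFin; concatMap; lookup; filter; filterᵇ; deduplicate)
open import Data.Product using (_×_; _,_; proj₁; proj₂; Σ; ∃)
open import Relation.Nullary using (¬_; does)
open import Relation.Binary.PropositionalEquality using (_≡_; _≢_)
open import Function.Definitions using (Injective)

record Graph : Set where
  field
    V     : ℕ
    edges : List (Fin V × Fin V)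

module _ (G : Graph) where
  open Graph G

  nE : ℕ
  nE = length edges

  incident : Fin nE → Fin V → Bool
  incident e x = does (proj₁ (lookup edges e) Fin.≟ x) ∨ does (proj₂ (lookup edges e) Fin.≟ x)

  inducedLabel : (Fin nE → ℕ) → Fin V → ℕ
  inducedLabel f x = sum (map f (filterᵇ (λ e → incident e x) (allFin nE)))

  -- f : E → [1, |E|] is a bijection (injective map of the |E|-element
  -- edge set into [1,|E|]) and adjacent vertices get distinct induced labels
  record LocalAntimagic (f : Fin nE → ℕ) : Set where
    field
      range     : ∀ e → 1 ≤ f e × f e ≤ nE
      injective : Injective _≡_ _≡_ f
      proper    : ∀ e → inducedLabel f (proj₁ (lookup edges e))
                          ≢ inducedLabel f (proj₂ (lookup edges e))

  numColours : (Fin nE → ℕ) → ℕ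
  numColours f = length (deduplicate ℕ._≟_ (map (inducedLabel f) (allFin V)))

  ChiLaEq : ℕ → Set
  ChiLaEq c = (Σ (Fin nE → ℕ) λ f → LocalAntimagic f × numColours f ≡ c)
            × (∀ f → LocalAntimagic f → c ≤ numColours f)

-- The labeling f of (2k+1)(P₂ ∨ O_{2n}) from the paper, on the edges
-- u_i x_{i,j'} and v_i x_{i,j'} (1 ≤ i ≤ 2k+1, 1 ≤ j' ≤ 2n, 1-based).

isOdd : ℕ → Bool
isOdd m = m % 2 ≡ᵇ 1

labU : (k n i j' : ℕ) → ℕ
labU k n i j' =
  if i ≤ᵇ k + 1
  then (if j' ≡ᵇ 2 * n ∸ 1 then 10 * k + 7 ∸ 2 * i
        else if j' ≡ᵇ 2 * n then 5 * k + 2 + i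
        else if isOdd j'
          -- j' = 2n - 2j + 1 :  k + 2 - i + jM
          then (let j = ⌊ (2 * n + 1 ∸ j') /2⌋ in k + 2 + j * M ∸ i)
          -- j' = 2n - 2j + 2 :  -3k - 2 + i + jM
          else (let j = ⌊ (2 * n + 2 ∸ j') /2⌋ in j * M + i ∸ (3 * k + 2)))
  else (if j' ≡ᵇ 2 * n ∸ 1 then 12 * k + 8 ∸ 2 * i
        else if j' ≡ᵇ 2 * n then 3 * k + 1 + i
        else if isOdd j'
          then (let j = ⌊ (2 * n + 1 ∸ j') /2⌋ in 3 * k + 3 + j * M ∸ i)
          else (let j = ⌊ (2 * n + 2 ∸ j') /2⌋ in j * M + i ∸ (5 * k + 3)))
  where
  M : ℕ
  M = 8 * k + 4

labV : (k n i j' : ℕ) → ℕ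
labV k n i j' =
  if i ≤ᵇ k + 1
  then (if j' ≡ᵇ 1 then 3 * k + 1 + i
        else if j' ≡ᵇ 2 then 8 * k + 6 ∸ 2 * i
        else if isOdd j'
          -- j' = 2j - 1 :  -5k - 3 + i + jM
          then (let j = ⌊ (j' + 1) /2⌋ in j * M + i ∸ (5 * k + 3))
          -- j' = 2j :  -k + 1 - i + jM
          else (let j = ⌊ j' /2⌋ in j * M + 1 ∸ (k + i)))
  else (if j' ≡ᵇ 1 then k + i
        else if j' ≡ᵇ 2 then 10 * k + 7 ∸ 2 * i
        else if isOdd j'
          then (let j = ⌊ (j' + 1) /2⌋ in j * M + i ∸ (7 * k + 4))
          else (let j = ⌊ j' /2⌋ in k + 2 + j * M ∸ i))
  where
  M : ℕ
  M = 8 * k + 4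

labX : (k n i j' : ℕ) → ℕ
labX k n i j' = labU k n i j' + labV k n i j'

kOf : (r s : ℕ) → ℕ
kOf r s = 2 * r * s + r + s      -- so that 2k+1 = (2r+1)(2s+1)

-- A choice, for every j ∈ [1,2n], of a partition of {x_{i,j} : i} into
-- blocks indexed by Fin (2r+1); blk j i is the block of x_{i,j}.
Blocks : (n r s : ℕ) → Set
Blocks n r s = Fin (2 * n) → Fin (2 * kOf r s + 1) → Fin (2 * r + 1)

record ValidBlocks (n r s : ℕ) (blk : Blocks n r s) : Set where
  field
    size : ∀ j b → length (filter (λ i → blk j i Fin.≟ b) (allFin (2 * kOf r s + 1)))
                     ≡ 2 * s + 1
    bsum : ∀ j b → sum (map (λ i → labX (kOf r s) n (suc (toℕ i)) (suc (toℕ j)))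
                           (filter (λ i → blk j i Fin.≟ b) (allFin (2 * kOf r s + 1))))
                     ≡ (2 * s + 1) * ((4 * kOf r s + 3) + n * (8 * kOf r s + 4))

-- The merged graph: vertices u_i, v_i (i ∈ Fin (2k+1)) and w_{j,b}
-- (the merged block b for index j); edges u_i v_i, u_i w_{j,blk j i},
-- v_i w_{j,blk j i}.
mergedGraph : (n r s : ℕ) → Blocks n r s → Graph
mergedGraph n r s blk = record { V = N ; edges = concatMap es (allFin K) }
  where
  K : ℕ
  K = 2 * kOf r s + 1
  W : ℕ
  W = 2 * n * (2 * r + 1)
  N : ℕ
  N = K + (K + W)
  u : Fin K → Fin N
  u i = i ↑ˡ (K + W)
  v : Fin K → Fin N
  v i = K ↑ʳ (i ↑ˡ W)
  w : Fin (2 * n) → Fin (2 * r + 1) → Fin N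
  w j b = K ↑ʳ (K ↑ʳ combine j b)
  es : Fin K → List (Fin N × Fin N)
  es i = (u i , v i) ∷ concatMap (λ j → (u i , w j (blk j i)) ∷ (v i , w j (blk j i)) ∷ []) (allFin (2 * n))

{-# OPTIONS --safe #-}
module Submission where

-- The labelling spends 1, …, 2k+1 on the edges u_i v_i and splits the remaining labels
-- into 4n bands of 2k+1 consecutive values, one band for each position j and side (u or v); inside
-- a band, the edge of row i sits at offset α(i) = i + k, β(i) = k − i or γ(i) = 2(k − i) modulo 2k+1.
-- These offsets are permutations, so the labelling is a bijection (it has an explicit inverse), and
-- since α + β = 2k and i + α + γ = 3k the sums f⁺(u_i) and f⁺(v_i) do not depend on i. A merged
-- vertex has f⁺ = (2s+1)P with P = 4k+3 + n(8k+4) by the block-sum hypothesis, whereas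
-- nP < f⁺(u_i) < (n+1)P and (n−1)P < f⁺(v_i) < nP. So the three colours are distinct and the
-- labelling is local antimagic with exactly 3 colours; conversely, any local antimagic labelling
-- needs 3 colours on a triangle u_i v_i w.

open import Defs
open import Algebra.Properties.CommutativeSemigroup using (interchange)
open import Data.Bool using (true; false; if_then_else_; _∨_)
open import Data.Bool.Properties using (∨-zeroʳ)
open import Data.Empty using (⊥-elim)
open import Data.Fin as Fin using (Fin; toℕ; _↑ˡ_; _↑ʳ_; combine; splitAt; remQuot)
import Data.Fin.Properties as Fin
open import Data.List using (List; []; _∷_; _++_; length; map; concat; concatMap; tabulate; allFin; lookup; filter; deduplicate)
open import Data.List.Properties using (length-++; length-map; map-++; map-tabulate; concat-map; concatMap-cong; tabulate-cong)
open import Data.List.Membership.Propositional using (_∈_)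
open import Data.List.Membership.Propositional.Properties
  using (∈-lookup; ∈-map⁺; ∈-map⁻; ∈-allFin; ∈-tabulate⁺; ∈-concat⁺′; ∈-deduplicate⁺; ∈-deduplicate⁻)
import Data.List.Relation.Unary.All as All
import Data.List.Relation.Unary.All.Properties as Allₚ
import Data.List.Relation.Unary.AllPairs as AllPairs
open import Data.List.Relation.Unary.Any using (here; there; index)
open import Data.List.Relation.Unary.Any.Properties using (lookup-index)
open import Data.List.Relation.Unary.Unique.Propositional using (Unique)
open import Data.Nat
open import Data.Nat.DivMod using (_%_; _/_; [m+kn]%n≡m%n; m<n⇒m%n≡m; +-distrib-/; m*n%n≡0; m*n/n≡m; m<n⇒m/n≡0)
open import Data.Nat.ListAction using (sum)
open import Data.Nat.ListAction.Properties using (sum-++)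
open import Data.Nat.Properties
open import Data.List.Relation.Unary.Unique.DecPropositional.Properties _≟_ using (deduplicate-!)
open import Data.Nat.Tactic.RingSolver using (solve-∀; solve)
open import Data.Product using (_×_; _,_; proj₁; proj₂)
open import Data.Sum using (inj₁; inj₂)
open import Data.Unit using (⊤; tt)
open import Function using (_∘_)
open import Level using (0ℓ)
open import Relation.Binary.PropositionalEquality
open import Relation.Nullary using (Dec; does; yes; no)
open import Relation.Nullary.Decidable using (dec-true; dec-false; T?)
open import Relation.Unary using (Pred; Decidable)

if-true : ∀ {A : Set} {b} {x y : A} → b ≡ true → (if b then x else y) ≡ x
if-true refl = refl

if-false : ∀ {A : Set} {b} {x y : A} → b ≡ false → (if b then x else y) ≡ y
if-false refl = refl

module _ {A : Set} {x y : A} where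

  if-≤ : ∀ {m n} → m ≤ n → (if m ≤ᵇ n then x else y) ≡ x
  if-≤ {m} {n} m≤n = if-true (dec-true (m ≤? n) m≤n)

  if-> : ∀ {m n} → n < m → (if m ≤ᵇ n then x else y) ≡ y
  if-> {m} {n} n<m = if-false (dec-false (m ≤? n) (<⇒≱ n<m))

  if-≡ : ∀ {m n} → m ≡ n → (if m ≡ᵇ n then x else y) ≡ x
  if-≡ {m} {n} m≡n = if-true (dec-true (m ≟ n) m≡n)

  if-≢ : ∀ {m n} → m ≢ n → (if m ≡ᵇ n then x else y) ≡ y
  if-≢ {m} {n} m≢n = if-false (dec-false (m ≟ n) m≢n)

m≡n+o⇒m∸o≡n : ∀ {m o} n → m ≡ n + o → m ∸ o ≡ n
m≡n+o⇒m∸o≡n {o = o} n refl = m+n∸n≡m n o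

n≡1+m+o⇒m<n : ∀ {m n} o → n ≡ suc (m + o) → m < n
n≡1+m+o⇒m<n o refl = s≤s (m≤m+n _ o)

m≡n+n⇒⌊m/2⌋≡n : ∀ {m} n → m ≡ n + n → ⌊ m /2⌋ ≡ n
m≡n+n⇒⌊m/2⌋≡n n refl = sym (n≡⌊n+n/2⌋ n)

isOdd-odd : ∀ m → isOdd (suc (2 * m)) ≡ true
isOdd-odd m = dec-true (suc (2 * m) % 2 ≟ 1) (trans (cong (_% 2) shape) ([m+kn]%n≡m%n 1 m 2))
  where
  shape : suc (2 * m) ≡ 1 + m * 2
  shape = solve (m ∷ [])

isOdd-even : ∀ m → isOdd (2 * m) ≡ false
isOdd-even m = dec-false (2 * m % 2 ≟ 1) λ odd → 0≢1+n (trans (sym even) odd)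
  where
  shape : 2 * m ≡ 0 + m * 2
  shape = solve (m ∷ [])
  even : 2 * m % 2 ≡ 0
  even = trans (cong (_% 2) shape) ([m+kn]%n≡m%n 0 m 2)

2[1+n]∸1 : ∀ n → 2 * suc n ∸ 1 ≡ suc (2 * n)
2[1+n]∸1 n = m≡n+o⇒m∸o≡n {2 * suc n} {1} (suc (2 * n)) (solve (n ∷ []))

[m*n+r]%n≡r : ∀ m n {r} .{{_ : NonZero n}} → r < n → (m * n + r) % n ≡ r
[m*n+r]%n≡r m n {r} r<n = trans (cong (_% n) (+-comm (m * n) r)) (trans ([m+kn]%n≡m%n r m n) (m<n⇒m%n≡m r<n))

[m*n+r]/n≡m : ∀ m n {r} .{{_ : NonZero n}} → r < n → (m * n + r) / n ≡ m
[m*n+r]/n≡m m n {r} r<n = begin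
  (m * n + r) / n    ≡⟨ +-distrib-/ (m * n) r remainders<n ⟩
  m * n / n + r / n  ≡⟨ cong₂ _+_ (m*n/n≡m m n) (m<n⇒m/n≡0 r<n) ⟩
  m + 0              ≡⟨ +-identityʳ m ⟩
  m                  ∎
  where
  open ≡-Reasoning
  remainders<n : m * n % n + r % n < n
  remainders<n = subst (_< n) (sym (cong₂ _+_ (m*n%n≡0 m n) (m<n⇒m%n≡m r<n))) r<n

between-multiples⇒≢ : ∀ {x p} a d → a * p < x → x < suc a * p → x ≢ d * p
between-multiples⇒≢ {p = p} a d lo hi refl with d ≤? a
... | yes d≤a = <⇒≱ lo (*-monoˡ-≤ p d≤a)
... | no  d≰a = <⇒≱ hi (*-monoˡ-≤ p (≰⇒> d≰a))

-- Defined through tabulate, so that a sum over allFin of a function of toℕ is Σ< by definition.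
Σ< : ℕ → (ℕ → ℕ) → ℕ
Σ< n f = sum (tabulate {n = n} (λ i → f (toℕ i)))

Σ<-cong : ∀ n {f g} → (∀ m → m < n → f m ≡ g m) → Σ< n f ≡ Σ< n g
Σ<-cong zero    f≡g = refl
Σ<-cong (suc n) f≡g = cong₂ _+_ (f≡g 0 z<s) (Σ<-cong n (λ m m<n → f≡g (suc m) (s<s m<n)))

Σ<-snoc : ∀ n f → Σ< (suc n) f ≡ Σ< n f + f n
Σ<-snoc zero    f = +-comm (f 0) 0
Σ<-snoc (suc n) f = trans (cong (f 0 +_) (Σ<-snoc n (λ m → f (suc m)))) (sym (+-assoc (f 0) _ _))

Σ<-+ : ∀ n f g → Σ< n (λ m → f m + g m) ≡ Σ< n f + Σ< n g
Σ<-+ zero    f g = refl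
Σ<-+ (suc n) f g = trans (cong (f 0 + g 0 +_) (Σ<-+ n (λ m → f (suc m)) (λ m → g (suc m))))
  (interchange +-commutativeSemigroup (f 0) (g 0) _ _)

Σ<-const : ∀ n c → Σ< n (λ _ → c) ≡ n * c
Σ<-const zero    c = refl
Σ<-const (suc n) c = cong (c +_) (Σ<-const n c)

Σ<-reverse : ∀ n f → Σ< n (λ m → f (n ∸ suc m)) ≡ Σ< n f
Σ<-reverse zero    f = refl
Σ<-reverse (suc n) f = trans (cong (f n +_) (Σ<-reverse n f)) (trans (+-comm (f n) _) (sym (Σ<-snoc n f)))

Σ<-pairs : ∀ n f → Σ< (2 * n) f ≡ Σ< n (λ m → f (2 * m) + f (suc (2 * m)))
Σ<-pairs zero    f = refl
Σ<-pairs (suc n) f = begin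
  Σ< (2 * suc n) f                                 ≡⟨ cong (λ l → Σ< l f) (*-suc 2 n) ⟩
  f 0 + (f 1 + Σ< (2 * n) (λ m → f (2 + m)))       ≡⟨ sym (+-assoc (f 0) (f 1) _) ⟩
  f 0 + f 1 + Σ< (2 * n) (λ m → f (2 + m))
    ≡⟨ cong (f 0 + f 1 +_) (Σ<-pairs n (λ m → f (2 + m))) ⟩
  f 0 + f 1 + Σ< n (λ m → f (2 + 2 * m) + f (3 + 2 * m))
    ≡⟨ cong (f 0 + f 1 +_) (Σ<-cong n λ m _ →
         cong₂ _+_ (cong f (sym (*-suc 2 m))) (cong (λ x → f (suc x)) (sym (*-suc 2 m)))) ⟩
  Σ< (suc n) (λ m → f (2 * m) + f (suc (2 * m)))   ∎
  where open ≡-Reasoning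

Σ<-odd : ∀ n c₀ b → Σ< n (λ q → c₀ + b * suc (2 * q)) ≡ n * c₀ + b * (n * n)
Σ<-odd zero    c₀ b = sym (*-zeroʳ b)
Σ<-odd (suc n) c₀ b = trans (Σ<-snoc n (λ q → c₀ + b * suc (2 * q)))
  (trans (cong (_+ (c₀ + b * suc (2 * n))) (Σ<-odd n c₀ b)) (step c₀ b n))
  where
  step : ∀ c₀ b n → n * c₀ + b * (n * n) + (c₀ + b * suc (2 * n)) ≡ suc n * c₀ + b * (suc n * suc n)
  step = solve-∀

AllAt : ∀ {A : Set} → (ℕ → A → Set) → ℕ → List A → Set
AllAt P c []       = ⊤
AllAt P c (x ∷ xs) = P c x × AllAt P (suc c) xs

module _ {A : Set} {P : ℕ → A → Set} where

  AllAt-++ : ∀ c xs {ys} → AllAt P c xs → AllAt P (c + length xs) ys → AllAt P c (xs ++ ys)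
  AllAt-++ c []       {ys} _          pys = subst (λ d → AllAt P d ys) (+-identityʳ c) pys
  AllAt-++ c (x ∷ xs) {ys} (px , pxs) pys =
    px , AllAt-++ (suc c) xs pxs (subst (λ d → AllAt P d ys) (+-suc c (length xs)) pys)

  AllAt-concat : ∀ {N} c L (f : Fin N → List A) → (∀ i → length (f i) ≡ L) →
    (∀ i → AllAt P (c + toℕ i * L) (f i)) → AllAt P c (concat (tabulate f))
  AllAt-concat {zero}  c L f |f|≡L pf = tt
  AllAt-concat {suc N} c L f |f|≡L pf = AllAt-++ c (f Fin.zero)
    (subst (λ d → AllAt P d (f Fin.zero)) (+-identityʳ c) (pf Fin.zero))
    (subst (λ d → AllAt P d (concat (tabulate (λ i → f (Fin.suc i))))) (cong (c +_) (sym (|f|≡L Fin.zero)))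
      (AllAt-concat (c + L) L (λ i → f (Fin.suc i)) (λ i → |f|≡L (Fin.suc i))
        (λ i → subst (λ d → AllAt P d (f (Fin.suc i))) (sym (+-assoc c L (toℕ i * L))) (pf (Fin.suc i)))))

length-concat-tabulate : ∀ {A : Set} {N} L (f : Fin N → List A) → (∀ i → length (f i) ≡ L) →
  length (concat (tabulate f)) ≡ N * L
length-concat-tabulate {N = zero}  L f |f|≡L = refl
length-concat-tabulate {N = suc N} L f |f|≡L = trans (length-++ (f Fin.zero))
  (cong₂ _+_ (|f|≡L Fin.zero) (length-concat-tabulate L (λ i → f (Fin.suc i)) (λ i → |f|≡L (Fin.suc i))))

sum-map-concat-tabulate : ∀ {A : Set} {N} (w : A → ℕ) (f : Fin N → List A) →
  sum (map w (concat (tabulate f))) ≡ sum (tabulate (λ i → sum (map w (f i))))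
sum-map-concat-tabulate {N = zero}  w f = refl
sum-map-concat-tabulate {N = suc N} w f = begin
  sum (map w (f Fin.zero ++ concat (tabulate (λ i → f (Fin.suc i)))))
    ≡⟨ cong sum (map-++ w (f Fin.zero) _) ⟩
  sum (map w (f Fin.zero) ++ map w (concat (tabulate (λ i → f (Fin.suc i)))))
    ≡⟨ sum-++ (map w (f Fin.zero)) _ ⟩
  sum (map w (f Fin.zero)) + sum (map w (concat (tabulate (λ i → f (Fin.suc i)))))
    ≡⟨ cong (sum (map w (f Fin.zero)) +_) (sum-map-concat-tabulate w (λ i → f (Fin.suc i))) ⟩
  sum (tabulate (λ i → sum (map w (f i)))) ∎
  where open ≡-Reasoning

sum-map-filter : ∀ {A : Set} {P : Pred A 0ℓ} (P? : Decidable P) (f : A → ℕ) xs →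
  sum (map f (filter P? xs)) ≡ sum (map (λ x → if does (P? x) then f x else 0) xs)
sum-map-filter P? f []       = refl
sum-map-filter P? f (x ∷ xs) with does (P? x)
... | true  = cong (f x +_) (sum-map-filter P? f xs)
... | false = sum-map-filter P? f xs

sum-tabulate-0 : ∀ {N} (f : Fin N → ℕ) → (∀ i → f i ≡ 0) → sum (tabulate f) ≡ 0
sum-tabulate-0 {zero}  f f≡0 = refl
sum-tabulate-0 {suc N} f f≡0 =
  cong₂ _+_ (f≡0 Fin.zero) (sum-tabulate-0 (λ i → f (Fin.suc i)) (λ i → f≡0 (Fin.suc i)))

sum-tabulate-single : ∀ {N} (f : Fin N → ℕ) i₀ → (∀ i → i ≢ i₀ → f i ≡ 0) → sum (tabulate f) ≡ f i₀
sum-tabulate-single {suc N} f Fin.zero f≡0 = trans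
  (cong (f Fin.zero +_) (sum-tabulate-0 (λ i → f (Fin.suc i)) (λ i → f≡0 (Fin.suc i) λ ())))
  (+-identityʳ (f Fin.zero))
sum-tabulate-single {suc N} f (Fin.suc i₀) f≡0 = cong₂ _+_ (f≡0 Fin.zero λ ())
  (sum-tabulate-single (λ i → f (Fin.suc i)) i₀ (λ i i≢i₀ → f≡0 (Fin.suc i) (i≢i₀ ∘ Fin.suc-injective)))

map-concat-tabulate : ∀ {A B : Set} {N} (f : A → B) (g : Fin N → List A) →
  map f (concat (tabulate g)) ≡ concatMap (map f ∘ g) (allFin N)
map-concat-tabulate f g = trans (sym (concat-map (tabulate g)))
  (cong concat (trans (map-tabulate g (map f)) (sym (map-tabulate (λ i → i) (map f ∘ g)))))

module _ {A : Set} where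
  open AllPairs using (_∷_)

  lookup-injective : ∀ {xs : List A} → Unique xs → ∀ {i j} → lookup xs i ≡ lookup xs j → i ≡ j
  lookup-injective (_     ∷ _) {Fin.zero}  {Fin.zero}  _  = refl
  lookup-injective (x∉xs ∷ _) {Fin.zero}  {Fin.suc j} eq = ⊥-elim (All.lookup x∉xs (∈-lookup j) eq)
  lookup-injective (x∉xs ∷ _) {Fin.suc i} {Fin.zero}  eq = ⊥-elim (All.lookup x∉xs (∈-lookup i) (sym eq))
  lookup-injective (_     ∷ u) {Fin.suc i} {Fin.suc j} eq = cong Fin.suc (lookup-injective u eq)

Unique⇒length≤ : ∀ {A : Set} {xs ys : List A} → Unique xs → (∀ {x} → x ∈ xs → x ∈ ys) →
  length xs ≤ length ys
Unique⇒length≤ {xs = xs} {ys} unique xs⊆ys = Fin.injective⇒≤ position-injective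
  where
  position : Fin (length xs) → Fin (length ys)
  position i = index (xs⊆ys (∈-lookup i))
  position-injective : ∀ {i j} → position i ≡ position j → i ≡ j
  position-injective {i} {j} eq = lookup-injective unique (begin
    lookup xs i                ≡⟨ lookup-index (xs⊆ys (∈-lookup i)) ⟩
    lookup ys (position i)     ≡⟨ cong (lookup ys) eq ⟩
    lookup ys (position j)     ≡⟨ lookup-index (xs⊆ys (∈-lookup j)) ⟨
    lookup xs j                ∎)
    where open ≡-Reasoning

inj₁≢inj₂ : ∀ {A B : Set} {a : A} {b : B} → inj₁ a ≢ inj₂ b
inj₁≢inj₂ ()

-- Counting colours

module _ (G : Graph) (f : Fin (nE G) → ℕ) where
  open Graph G
  open All using ([]; _∷_)
  open AllPairs using ([]; _∷_)

  numColours≤ : (cs : List ℕ) → (∀ x → inducedLabel G f x ∈ cs) → numColours G f ≤ length cs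
  numColours≤ cs coloured = Unique⇒length≤ (deduplicate-! labels) λ c∈ →
    let (x , _ , c≡) = ∈-map⁻ (inducedLabel G f) (∈-deduplicate⁻ _≟_ labels c∈)
    in  subst (_∈ cs) (sym c≡) (coloured x)
    where
    labels : List ℕ
    labels = map (inducedLabel G f) (allFin V)

  private
    colour∈ : ∀ x → inducedLabel G f x ∈ deduplicate _≟_ (map (inducedLabel G f) (allFin V))
    colour∈ x = ∈-deduplicate⁺ _≟_ (∈-map⁺ (inducedLabel G f) (∈-allFin x))

  3≤numColours : ∀ {a b c} → inducedLabel G f a ≢ inducedLabel G f b → inducedLabel G f a ≢ inducedLabel G f c →
    inducedLabel G f b ≢ inducedLabel G f c → 3 ≤ numColours G f
  3≤numColours {a} {b} {c} a≢b a≢c b≢c =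
    Unique⇒length≤ ((a≢b ∷ a≢c ∷ []) ∷ (b≢c ∷ []) ∷ [] ∷ []) λ where
    (here refl)                 → colour∈ a
    (there (here refl))         → colour∈ b
    (there (there (here refl))) → colour∈ c

  edge-proper : LocalAntimagic G f → ∀ {a b} → (a , b) ∈ edges → inducedLabel G f a ≢ inducedLabel G f b
  edge-proper antimagic ab∈ = subst (λ e → inducedLabel G f (proj₁ e) ≢ inducedLabel G f (proj₂ e))
    (sym (lookup-index ab∈)) (LocalAntimagic.proper antimagic (index ab∈))

  triangle⇒3≤numColours : LocalAntimagic G f → ∀ {a b c} →
    (a , b) ∈ edges → (a , c) ∈ edges → (b , c) ∈ edges → 3 ≤ numColours G f
  triangle⇒3≤numColours antimagic ab ac bc =
    3≤numColours (edge-proper antimagic ab) (edge-proper antimagic ac) (edge-proper antimagic bc)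

LabelledEdges : ℕ → Set
LabelledEdges V = List ((Fin V × Fin V) × ℕ)

graphOf : ∀ V → LabelledEdges V → Graph
graphOf V Z = record { V = V ; edges = map proj₁ Z }

labelOf : ∀ {V} (Z : LabelledEdges V) → Fin (nE (graphOf V Z)) → ℕ
labelOf (z ∷ Z) Fin.zero    = proj₂ z
labelOf (z ∷ Z) (Fin.suc e) = labelOf Z e

AllAt-labelOf : ∀ {V} {P : ℕ → ℕ → Set} c (Z : LabelledEdges V) → AllAt (λ p z → P p (proj₂ z)) c Z →
  ∀ e → P (c + toℕ e) (labelOf Z e)
AllAt-labelOf {P = P} c (z ∷ Z) (pz , _)  Fin.zero    = subst (λ p → P p (proj₂ z)) (sym (+-identityʳ c)) pz
AllAt-labelOf {P = P} c (z ∷ Z) (_ , pZ) (Fin.suc e) =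
  subst (λ p → P p (labelOf Z e)) (sym (+-suc c (toℕ e))) (AllAt-labelOf (suc c) Z pZ e)

weight : ∀ {V} → Fin V → (Fin V × Fin V) × ℕ → ℕ
weight x z = if does (proj₁ (proj₁ z) Fin.≟ x) ∨ does (proj₂ (proj₁ z) Fin.≟ x) then proj₂ z else 0

inducedLabel-labelOf : ∀ {V} (Z : LabelledEdges V) x →
  inducedLabel (graphOf V Z) (labelOf Z) x ≡ sum (map (weight x) Z)
inducedLabel-labelOf {V} Z x = trans (sum-map-filter (λ e → T? (incident (graphOf V Z) e x)) (labelOf Z) (allFin _))
  (trans (cong sum (map-tabulate (λ e → e) (λ e → if incident (graphOf V Z) e x then labelOf Z e else 0)))
    (weights Z))
  where
  weights : ∀ Z → sum (tabulate (λ e → if incident (graphOf V Z) e x then labelOf Z e else 0))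
                ≡ sum (map (weight x) Z)
  weights []      = refl
  weights (z ∷ Z) = cong (weight x z +_) (weights Z)

module _ {V} (a b : Fin V) (ℓ : ℕ) where

  weight-source : weight a ((a , b) , ℓ) ≡ ℓ
  weight-source = if-true (cong (_∨ does (b Fin.≟ a)) (dec-true (a Fin.≟ a) refl))

  weight-target : weight b ((a , b) , ℓ) ≡ ℓ
  weight-target = if-true (trans (cong (does (a Fin.≟ b) ∨_) (dec-true (b Fin.≟ b) refl)) (∨-zeroʳ _))

  weight-elsewhere : ∀ {x} → a ≢ x → b ≢ x → weight x ((a , b) , ℓ) ≡ 0
  weight-elsewhere {x} a≢x b≢x = if-false (cong₂ _∨_ (dec-false (a Fin.≟ x) a≢x) (dec-false (b Fin.≟ x) b≢x))

-- Bands and offsets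

-- The labels above 2k+1 form 4n bands of 2k+1 consecutive values. For the pair m of positions
-- j = 2m+1, 2m+2, followed by q = n−1−m further pairs, the edges u_i x_{i,j} lie in the bands
-- 4q+3 and 4q+1 and the edges v_i x_{i,j} in the bands 4m and 4m+2.
band : (k c r : ℕ) → ℕ
band k c r = 2 * k + 2 + c * (2 * k + 1) + r

-- i + k, k − i and 2(k − i) modulo 2k+1, for the 0-based row index i (labU and labV take i + 1).
rotate reflect double : ℕ → ℕ → ℕ
rotate  k i = if i ≤ᵇ k then i + k         else i ∸ suc k
reflect k i = if i ≤ᵇ k then k ∸ i         else 3 * k + 1 ∸ i
double  k i = if i ≤ᵇ k then 2 * k ∸ 2 * i else 4 * k + 1 ∸ 2 * i

pairOffset : ℕ → ℕ → ℕ → ℕ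
pairOffset k zero    = double k
pairOffset k (suc _) = reflect k

unrotate halve : ℕ → ℕ → ℕ
unrotate k r = if k ≤ᵇ r then r ∸ k else r + suc k
halve    k r = if isOdd r then ⌊ 4 * k + 1 ∸ r /2⌋ else k ∸ ⌊ r /2⌋

unPairOffset : ℕ → ℕ → ℕ → ℕ
unPairOffset k zero    = halve k
unPairOffset k (suc _) = reflect k

-- i ≤ k or k < i ≤ 2k, parametrised so that the arithmetic of each case is free of truncated subtraction.
data LowerUpper : ℕ → ℕ → Set where
  lower : ∀ i a → LowerUpper (i + a) i
  upper : ∀ a c → LowerUpper (suc (a + c)) (suc (suc (a + c)) + a)

1+k+a<2k+1⇒a<k : ∀ k a → suc k + a < 2 * k + 1 → a < k
1+k+a<2k+1⇒a<k k a h = +-cancelˡ-< k a k (s≤s⁻¹ (≤-trans h (≤-reflexive 2k+1≡)))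
  where
  2k+1≡ : 2 * k + 1 ≡ suc (k + k)
  2k+1≡ = solve (k ∷ [])

lowerUpper : ∀ k i → i < 2 * k + 1 → LowerUpper k i
lowerUpper k i i<K with i ≤? k
... | yes i≤k with a , refl ← m≤n⇒∃[o]m+o≡n i≤k = lower i a
... | no  i≰k with a , refl ← m≤n⇒∃[o]m+o≡n (≰⇒> i≰k)
              with c , refl ← m≤n⇒∃[o]m+o≡n (1+k+a<2k+1⇒a<k k a i<K) = upper a c

upper-k<i : ∀ a c → suc (a + c) < suc (suc (a + c)) + a
upper-k<i a c = s≤s (m≤m+n (suc (a + c)) a)

rotate-lower : ∀ i a → rotate (i + a) i ≡ i + (i + a)
rotate-lower i a = if-≤ (m≤m+n i a)

rotate-upper : ∀ a c → rotate (suc (a + c)) (suc (suc (a + c)) + a) ≡ a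
rotate-upper a c = trans (if-> (upper-k<i a c)) (m≡n+o⇒m∸o≡n a (+-comm (suc (suc (a + c))) a))

reflect-lower : ∀ i a → reflect (i + a) i ≡ a
reflect-lower i a = trans (if-≤ (m≤m+n i a)) (m≡n+o⇒m∸o≡n a (+-comm i a))

reflect-upper : ∀ a c → reflect (suc (a + c)) (suc (suc (a + c)) + a) ≡ a + 2 * c + 2
reflect-upper a c = trans (if-> (upper-k<i a c))
  (m≡n+o⇒m∸o≡n {3 * suc (a + c) + 1} {suc (suc (a + c)) + a} _ (solve (a ∷ c ∷ [])))

double-lower : ∀ i a → double (i + a) i ≡ 2 * a
double-lower i a = trans (if-≤ (m≤m+n i a))
  (m≡n+o⇒m∸o≡n {2 * (i + a)} {2 * i} _ (solve (i ∷ a ∷ [])))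

double-upper : ∀ a c → double (suc (a + c)) (suc (suc (a + c)) + a) ≡ suc (2 * c)
double-upper a c = trans (if-> (upper-k<i a c))
  (m≡n+o⇒m∸o≡n {4 * suc (a + c) + 1} {2 * (suc (suc (a + c)) + a)} _ (solve (a ∷ c ∷ [])))

rotate+reflect : ∀ k i → i < 2 * k + 1 → rotate k i + reflect k i ≡ 2 * k
rotate+reflect k i i<K with lowerUpper k i i<K
... | lower _ a = trans (cong₂ _+_ (rotate-lower i a) (reflect-lower i a)) (solve (i ∷ a ∷ []))
... | upper a c = trans (cong₂ _+_ (rotate-upper a c) (reflect-upper a c)) (solve (a ∷ c ∷ []))

i+rotate+double : ∀ k i → i < 2 * k + 1 → i + (rotate k i + double k i) ≡ 3 * k
i+rotate+double k i i<K with lowerUpper k i i<K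
... | lower _ a = trans (cong (i +_) (cong₂ _+_ (rotate-lower i a) (double-lower i a)))
  (solve (i ∷ a ∷ []))
... | upper a c = trans (cong (suc (suc (a + c)) + a +_) (cong₂ _+_ (rotate-upper a c) (double-upper a c)))
  (solve (a ∷ c ∷ []))

≤2k⇒<2k+1 : ∀ k {x} → x ≤ 2 * k → x < 2 * k + 1
≤2k⇒<2k+1 k x≤2k = ≤-<-trans x≤2k (m<m+n (2 * k) z<s)

rotate-< : ∀ k i → i < 2 * k + 1 → rotate k i < 2 * k + 1
rotate-< k i i<K = ≤2k⇒<2k+1 k (subst (rotate k i ≤_) (rotate+reflect k i i<K) (m≤m+n _ _))

reflect-< : ∀ k i → i < 2 * k + 1 → reflect k i < 2 * k + 1
reflect-< k i i<K = ≤2k⇒<2k+1 k (subst (reflect k i ≤_) (rotate+reflect k i i<K) (m≤n+m _ _))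

double-< : ∀ k i → i < 2 * k + 1 → double k i < 2 * k + 1
double-< k i i<K with lowerUpper k i i<K
... | lower _ a = subst (_< 2 * (i + a) + 1) (sym (double-lower i a))
  (n≡1+m+o⇒m<n {2 * a} {2 * (i + a) + 1} (2 * i) (solve (i ∷ a ∷ [])))
... | upper a c = subst (_< 2 * suc (a + c) + 1) (sym (double-upper a c))
  (n≡1+m+o⇒m<n {suc (2 * c)} {2 * suc (a + c) + 1} (2 * a + 1) (solve (a ∷ c ∷ [])))

pairOffset-< : ∀ k q i → i < 2 * k + 1 → pairOffset k q i < 2 * k + 1
pairOffset-< k zero    = double-< k
pairOffset-< k (suc _) = reflect-< k

unrotate-rotate : ∀ k i → i < 2 * k + 1 → unrotate k (rotate k i) ≡ i
unrotate-rotate k i i<K with lowerUpper k i i<K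
... | lower _ a = trans (cong (unrotate (i + a)) (rotate-lower i a))
  (trans (if-≤ (m≤n+m (i + a) i)) (m+n∸n≡m i (i + a)))
... | upper a c = trans (cong (unrotate (suc (a + c))) (rotate-upper a c))
  (trans (if-> (s≤s (m≤m+n a c))) (+-comm a (suc (suc (a + c)))))

reflect-reflect : ∀ k i → i < 2 * k + 1 → reflect k (reflect k i) ≡ i
reflect-reflect k i i<K with lowerUpper k i i<K
... | lower _ a = trans (cong (reflect (i + a)) (reflect-lower i a))
  (trans (if-≤ (m≤n+m a i)) (m+n∸n≡m i a))
... | upper a c = trans (cong (reflect (suc (a + c))) (reflect-upper a c))
  (trans (if-> (n≡1+m+o⇒m<n {suc (a + c)} {a + 2 * c + 2} c (solve (a ∷ c ∷ []))))
    (m≡n+o⇒m∸o≡n {3 * suc (a + c) + 1} {a + 2 * c + 2} _ (solve (a ∷ c ∷ []))))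

halve-double : ∀ k i → i < 2 * k + 1 → halve k (double k i) ≡ i
halve-double k i i<K with lowerUpper k i i<K
... | lower _ a = trans (cong (halve (i + a)) (double-lower i a))
  (trans (if-false (isOdd-even a))
    (trans (cong (i + a ∸_) (m≡n+n⇒⌊m/2⌋≡n {2 * a} a (solve (a ∷ [])))) (m+n∸n≡m i a)))
... | upper a c = trans (cong (halve (suc (a + c))) (double-upper a c))
  (trans (if-true (isOdd-odd c)) (m≡n+n⇒⌊m/2⌋≡n (suc (suc (a + c)) + a)
    (m≡n+o⇒m∸o≡n {4 * suc (a + c) + 1} {suc (2 * c)} _ (solve (a ∷ c ∷ [])))))

unPairOffset-pairOffset : ∀ k q i → i < 2 * k + 1 → unPairOffset k q (pairOffset k q i) ≡ i
unPairOffset-pairOffset k zero    = halve-double k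
unPairOffset-pairOffset k (suc _) = reflect-reflect k

-- Evaluating the labelling

module _ {A : Set} {x y : A} where

  lower-branch : ∀ i a → (if suc i ≤ᵇ i + a + 1 then x else y) ≡ x
  lower-branch i a = if-≤ (subst (suc i ≤_) (+-comm 1 (i + a)) (s≤s (m≤m+n i a)))

  upper-branch : ∀ a c → (if suc (suc (suc (a + c)) + a) ≤ᵇ suc (a + c) + 1 then x else y) ≡ y
  upper-branch a c = if-> (subst (_< suc (suc (suc (a + c)) + a)) (+-comm 1 (suc (a + c))) (s≤s (upper-k<i a c)))

-- The ring solver treats band as an atom, so these identities are stated with band unfolded.
∸-band : ∀ {x y r r₀} k c → r ≡ r₀ → x ≡ 2 * k + 2 + c * (2 * k + 1) + r₀ + y → x ∸ y ≡ band k c r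
∸-band {y = y} {r₀ = r₀} k c refl = m≡n+o⇒m∸o≡n {o = y} (band k c r₀)

≡-band : ∀ {x r r₀} k c → r ≡ r₀ → x ≡ 2 * k + 2 + c * (2 * k + 1) + r₀ → x ≡ band k c r
≡-band k c refl x≡ = x≡

labU-oddLast : ∀ k m i → labU k (suc (m + 0)) i (suc (2 * m))
  ≡ (if i ≤ᵇ k + 1 then 10 * k + 7 ∸ 2 * i else 12 * k + 8 ∸ 2 * i)
labU-oddLast k m i = cong₂ (if_then_else_ (i ≤ᵇ k + 1)) (if-≡ last) (if-≡ last)
  where
  last : suc (2 * m) ≡ 2 * suc (m + 0) ∸ 1
  last = sym (trans (2[1+n]∸1 (m + 0)) (cong (λ x → suc (2 * x)) (+-identityʳ m)))

labU-evenLast : ∀ k m i → labU k (suc (m + 0)) i (2 + 2 * m)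
  ≡ (if i ≤ᵇ k + 1 then 5 * k + 2 + i else 3 * k + 1 + i)
labU-evenLast k m i = cong₂ (if_then_else_ (i ≤ᵇ k + 1))
  (trans (if-≢ notPenultimate) (if-≡ last)) (trans (if-≢ notPenultimate) (if-≡ last))
  where
  last : 2 + 2 * m ≡ 2 * suc (m + 0)
  last = solve (m ∷ [])
  notPenultimate : 2 + 2 * m ≢ 2 * suc (m + 0) ∸ 1
  notPenultimate eq = 1+n≢n (trans (trans eq (2[1+n]∸1 (m + 0))) (cong (λ x → suc (2 * x)) (+-identityʳ m)))

labU-oddEarlier : ∀ k m q i → labU k (suc (m + suc q)) i (suc (2 * m))
  ≡ (if i ≤ᵇ k + 1 then k + 2 + (2 + q) * (8 * k + 4) ∸ i else 3 * k + 3 + (2 + q) * (8 * k + 4) ∸ i)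
labU-oddEarlier k m q i = cong₂ (if_then_else_ (i ≤ᵇ k + 1))
  (trans (if-≢ ≢2n-1) (trans (if-≢ ≢2n) (trans (if-true (isOdd-odd m))
    (cong (λ j → k + 2 + j * (8 * k + 4) ∸ i) j≡))))
  (trans (if-≢ ≢2n-1) (trans (if-≢ ≢2n) (trans (if-true (isOdd-odd m))
    (cong (λ j → 3 * k + 3 + j * (8 * k + 4) ∸ i) j≡))))
  where
  ≢2n-1 : suc (2 * m) ≢ 2 * suc (m + suc q) ∸ 1
  ≢2n-1 eq = <⇒≢ (n≡1+m+o⇒m<n {suc (2 * m)} {suc (2 * (m + suc q))} (2 * q + 1) (solve (m ∷ q ∷ [])))
    (trans eq (2[1+n]∸1 (m + suc q)))
  ≢2n : suc (2 * m) ≢ 2 * suc (m + suc q)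
  ≢2n = <⇒≢ (n≡1+m+o⇒m<n {suc (2 * m)} {2 * suc (m + suc q)} (2 * q + 2) (solve (m ∷ q ∷ [])))
  j≡ : ⌊ 2 * suc (m + suc q) + 1 ∸ suc (2 * m) /2⌋ ≡ 2 + q
  j≡ = m≡n+n⇒⌊m/2⌋≡n (2 + q)
    (m≡n+o⇒m∸o≡n {2 * suc (m + suc q) + 1} {suc (2 * m)} ((2 + q) + (2 + q)) (solve (m ∷ q ∷ [])))

labU-evenEarlier : ∀ k m q i → labU k (suc (m + suc q)) i (2 + 2 * m)
  ≡ (if i ≤ᵇ k + 1 then (2 + q) * (8 * k + 4) + i ∸ (3 * k + 2)
                   else (2 + q) * (8 * k + 4) + i ∸ (5 * k + 3))
labU-evenEarlier k m q i = cong₂ (if_then_else_ (i ≤ᵇ k + 1))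
  (trans (if-≢ ≢2n-1) (trans (if-≢ ≢2n) (trans (if-false even)
    (cong (λ j → j * (8 * k + 4) + i ∸ (3 * k + 2)) j≡))))
  (trans (if-≢ ≢2n-1) (trans (if-≢ ≢2n) (trans (if-false even)
    (cong (λ j → j * (8 * k + 4) + i ∸ (5 * k + 3)) j≡))))
  where
  ≢2n-1 : 2 + 2 * m ≢ 2 * suc (m + suc q) ∸ 1
  ≢2n-1 eq = <⇒≢ (n≡1+m+o⇒m<n {2 + 2 * m} {suc (2 * (m + suc q))} (2 * q) (solve (m ∷ q ∷ [])))
    (trans eq (2[1+n]∸1 (m + suc q)))
  ≢2n : 2 + 2 * m ≢ 2 * suc (m + suc q)
  ≢2n = <⇒≢ (n≡1+m+o⇒m<n {2 + 2 * m} {2 * suc (m + suc q)} (2 * q + 1) (solve (m ∷ q ∷ [])))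
  even : isOdd (2 + 2 * m) ≡ false
  even = trans (cong isOdd (sym (*-suc 2 m))) (isOdd-even (suc m))
  j≡ : ⌊ 2 * suc (m + suc q) + 2 ∸ (2 + 2 * m) /2⌋ ≡ 2 + q
  j≡ = m≡n+n⇒⌊m/2⌋≡n (2 + q)
    (m≡n+o⇒m∸o≡n {2 * suc (m + suc q) + 2} {2 + 2 * m} ((2 + q) + (2 + q)) (solve (m ∷ q ∷ [])))

labV-oddLater : ∀ k n m i → labV k n i (suc (2 * suc m))
  ≡ (if i ≤ᵇ k + 1 then (2 + m) * (8 * k + 4) + i ∸ (5 * k + 3)
                   else (2 + m) * (8 * k + 4) + i ∸ (7 * k + 4))
labV-oddLater k n m i = cong₂ (if_then_else_ (i ≤ᵇ k + 1))
  (trans (if-≢ ≢2) (trans (if-true (isOdd-odd (suc m))) (cong (λ j → j * (8 * k + 4) + i ∸ (5 * k + 3)) j≡)))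
  (trans (if-≢ ≢2) (trans (if-true (isOdd-odd (suc m))) (cong (λ j → j * (8 * k + 4) + i ∸ (7 * k + 4)) j≡)))
  where
  ≢2 : suc (2 * suc m) ≢ 2
  ≢2 = ≢-sym (<⇒≢ (n≡1+m+o⇒m<n {2} {suc (2 * suc m)} (2 * m) (solve (m ∷ []))))
  j≡ : ⌊ suc (2 * suc m) + 1 /2⌋ ≡ 2 + m
  j≡ = m≡n+n⇒⌊m/2⌋≡n (2 + m) (solve (m ∷ []))

labV-evenLater : ∀ k n m i → labV k n i (2 + 2 * suc m)
  ≡ (if i ≤ᵇ k + 1 then (2 + m) * (8 * k + 4) + 1 ∸ (k + i) else k + 2 + (2 + m) * (8 * k + 4) ∸ i)
labV-evenLater k n m i = cong₂ (if_then_else_ (i ≤ᵇ k + 1))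
  (trans (if-false even) (cong (λ j → j * (8 * k + 4) + 1 ∸ (k + i)) j≡))
  (trans (if-false even) (cong (λ j → k + 2 + j * (8 * k + 4) ∸ i) j≡))
  where
  even : isOdd (2 + 2 * suc m) ≡ false
  even = trans (cong isOdd (sym (*-suc 2 (suc m)))) (isOdd-even (2 + m))
  j≡ : ⌊ 2 + 2 * suc m /2⌋ ≡ 2 + m
  j≡ = m≡n+n⇒⌊m/2⌋≡n (2 + m) (solve (m ∷ []))

labU-odd : ∀ k m q i → i < 2 * k + 1 →
  labU k (suc (m + q)) (suc i) (suc (2 * m)) ≡ band k (4 * q + 3) (pairOffset k q i)
labU-odd k m zero i i<K with lowerUpper k i i<K
... | lower _ a = trans (labU-oddLast (i + a) m (suc i))
  (trans (lower-branch i a) (∸-band (i + a) 3 (double-lower i a) arith))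
  where
  arith : 10 * (i + a) + 7 ≡ 2 * (i + a) + 2 + 3 * (2 * (i + a) + 1) + 2 * a + 2 * suc i
  arith = solve (i ∷ a ∷ [])
... | upper a c = trans (labU-oddLast (suc (a + c)) m (suc (suc (suc (a + c)) + a)))
  (trans (upper-branch a c) (∸-band (suc (a + c)) 3 (double-upper a c) arith))
  where
  arith : 12 * suc (a + c) + 8
        ≡ 2 * suc (a + c) + 2 + 3 * (2 * suc (a + c) + 1) + suc (2 * c) + 2 * suc (suc (suc (a + c)) + a)
  arith = solve (a ∷ c ∷ [])
labU-odd k m (suc q) i i<K with lowerUpper k i i<K
... | lower _ a = trans (labU-oddEarlier (i + a) m q (suc i))
  (trans (lower-branch i a) (∸-band (i + a) (4 * suc q + 3) (reflect-lower i a) arith))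
  where
  arith : i + a + 2 + (2 + q) * (8 * (i + a) + 4)
        ≡ 2 * (i + a) + 2 + (4 * suc q + 3) * (2 * (i + a) + 1) + a + suc i
  arith = solve (i ∷ a ∷ q ∷ [])
... | upper a c = trans (labU-oddEarlier (suc (a + c)) m q (suc (suc (suc (a + c)) + a)))
  (trans (upper-branch a c) (∸-band (suc (a + c)) (4 * suc q + 3) (reflect-upper a c) arith))
  where
  arith : 3 * suc (a + c) + 3 + (2 + q) * (8 * suc (a + c) + 4)
        ≡ 2 * suc (a + c) + 2 + (4 * suc q + 3) * (2 * suc (a + c) + 1) + (a + 2 * c + 2)
          + suc (suc (suc (a + c)) + a)
  arith = solve (a ∷ c ∷ q ∷ [])

labU-even : ∀ k m q i → i < 2 * k + 1 →
  labU k (suc (m + q)) (suc i) (2 + 2 * m) ≡ band k (4 * q + 1) (rotate k i)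
labU-even k m zero i i<K with lowerUpper k i i<K
... | lower _ a = trans (labU-evenLast (i + a) m (suc i))
  (trans (lower-branch i a) (≡-band (i + a) 1 (rotate-lower i a) arith))
  where
  arith : 5 * (i + a) + 2 + suc i ≡ 2 * (i + a) + 2 + 1 * (2 * (i + a) + 1) + (i + (i + a))
  arith = solve (i ∷ a ∷ [])
... | upper a c = trans (labU-evenLast (suc (a + c)) m (suc (suc (suc (a + c)) + a)))
  (trans (upper-branch a c) (≡-band (suc (a + c)) 1 (rotate-upper a c) arith))
  where
  arith : 3 * suc (a + c) + 1 + suc (suc (suc (a + c)) + a) ≡ 2 * suc (a + c) + 2 + 1 * (2 * suc (a + c) + 1) + a
  arith = solve (a ∷ c ∷ [])
labU-even k m (suc q) i i<K with lowerUpper k i i<K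
... | lower _ a = trans (labU-evenEarlier (i + a) m q (suc i))
  (trans (lower-branch i a) (∸-band (i + a) (4 * suc q + 1) (rotate-lower i a) arith))
  where
  arith : (2 + q) * (8 * (i + a) + 4) + suc i
        ≡ 2 * (i + a) + 2 + (4 * suc q + 1) * (2 * (i + a) + 1) + (i + (i + a)) + (3 * (i + a) + 2)
  arith = solve (i ∷ a ∷ q ∷ [])
... | upper a c = trans (labU-evenEarlier (suc (a + c)) m q (suc (suc (suc (a + c)) + a)))
  (trans (upper-branch a c) (∸-band (suc (a + c)) (4 * suc q + 1) (rotate-upper a c) arith))
  where
  arith : (2 + q) * (8 * suc (a + c) + 4) + suc (suc (suc (a + c)) + a)
        ≡ 2 * suc (a + c) + 2 + (4 * suc q + 1) * (2 * suc (a + c) + 1) + a + (5 * suc (a + c) + 3)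
  arith = solve (a ∷ c ∷ q ∷ [])

labV-odd : ∀ k n m i → i < 2 * k + 1 →
  labV k n (suc i) (suc (2 * m)) ≡ band k (4 * m) (rotate k i)
labV-odd k n zero i i<K with lowerUpper k i i<K
... | lower _ a = trans (lower-branch i a) (≡-band (i + a) 0 (rotate-lower i a) arith)
  where
  arith : 3 * (i + a) + 1 + suc i ≡ 2 * (i + a) + 2 + 0 * (2 * (i + a) + 1) + (i + (i + a))
  arith = solve (i ∷ a ∷ [])
... | upper a c = trans (upper-branch a c) (≡-band (suc (a + c)) 0 (rotate-upper a c) arith)
  where
  arith : suc (a + c) + suc (suc (suc (a + c)) + a) ≡ 2 * suc (a + c) + 2 + 0 * (2 * suc (a + c) + 1) + a
  arith = solve (a ∷ c ∷ [])
labV-odd k n (suc m) i i<K with lowerUpper k i i<K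
... | lower _ a = trans (labV-oddLater (i + a) n m (suc i))
  (trans (lower-branch i a) (∸-band (i + a) (4 * suc m) (rotate-lower i a) arith))
  where
  arith : (2 + m) * (8 * (i + a) + 4) + suc i
        ≡ 2 * (i + a) + 2 + 4 * suc m * (2 * (i + a) + 1) + (i + (i + a)) + (5 * (i + a) + 3)
  arith = solve (i ∷ a ∷ m ∷ [])
... | upper a c = trans (labV-oddLater (suc (a + c)) n m (suc (suc (suc (a + c)) + a)))
  (trans (upper-branch a c) (∸-band (suc (a + c)) (4 * suc m) (rotate-upper a c) arith))
  where
  arith : (2 + m) * (8 * suc (a + c) + 4) + suc (suc (suc (a + c)) + a)
        ≡ 2 * suc (a + c) + 2 + 4 * suc m * (2 * suc (a + c) + 1) + a + (7 * suc (a + c) + 4)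
  arith = solve (a ∷ c ∷ m ∷ [])

labV-even : ∀ k n m i → i < 2 * k + 1 →
  labV k n (suc i) (2 + 2 * m) ≡ band k (4 * m + 2) (pairOffset k m i)
labV-even k n zero i i<K with lowerUpper k i i<K
... | lower _ a = trans (lower-branch i a) (∸-band (i + a) 2 (double-lower i a) arith)
  where
  arith : 8 * (i + a) + 6 ≡ 2 * (i + a) + 2 + 2 * (2 * (i + a) + 1) + 2 * a + 2 * suc i
  arith = solve (i ∷ a ∷ [])
... | upper a c = trans (upper-branch a c) (∸-band (suc (a + c)) 2 (double-upper a c) arith)
  where
  arith : 10 * suc (a + c) + 7
        ≡ 2 * suc (a + c) + 2 + 2 * (2 * suc (a + c) + 1) + suc (2 * c) + 2 * suc (suc (suc (a + c)) + a)
  arith = solve (a ∷ c ∷ [])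
labV-even k n (suc m) i i<K with lowerUpper k i i<K
... | lower _ a = trans (labV-evenLater (i + a) n m (suc i))
  (trans (lower-branch i a) (∸-band (i + a) (4 * suc m + 2) (reflect-lower i a) arith))
  where
  arith : (2 + m) * (8 * (i + a) + 4) + 1
        ≡ 2 * (i + a) + 2 + (4 * suc m + 2) * (2 * (i + a) + 1) + a + (i + a + suc i)
  arith = solve (i ∷ a ∷ m ∷ [])
... | upper a c = trans (labV-evenLater (suc (a + c)) n m (suc (suc (suc (a + c)) + a)))
  (trans (upper-branch a c) (∸-band (suc (a + c)) (4 * suc m + 2) (reflect-upper a c) arith))
  where
  arith : suc (a + c) + 2 + (2 + m) * (8 * suc (a + c) + 4)
        ≡ 2 * suc (a + c) + 2 + (4 * suc m + 2) * (2 * suc (a + c) + 1) + (a + 2 * c + 2)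
          + suc (suc (suc (a + c)) + a)
  arith = solve (a ∷ c ∷ m ∷ [])

-- Vertex sums and colours

uColour vColour : ℕ → ℕ → ℕ
uColour k n = 8 * n * n * k + 6 * n * k + 4 * n * n + 4 * n + k + 1
vColour k n = 8 * n * n * k + 2 * n * k + 4 * n * n + 2 * n + k + 1

pairTotal : (k i c₀ q : ℕ) → ℕ
pairTotal k i c₀ q = c₀ + 4 * (2 * k + 1) * suc (2 * q) + (rotate k i + pairOffset k q i)

band-3+band-1 : ∀ k q x y →
  band k (4 * q + 3) x + band k (4 * q + 1) y ≡ 4 * k + 4 + 4 * (2 * k + 1) * suc (2 * q) + (y + x)
band-3+band-1 k q x y = expanded
  where
  expanded : 2 * k + 2 + (4 * q + 3) * (2 * k + 1) + x + (2 * k + 2 + (4 * q + 1) * (2 * k + 1) + y)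
           ≡ 4 * k + 4 + 4 * (2 * k + 1) * suc (2 * q) + (y + x)
  expanded = solve (k ∷ q ∷ x ∷ y ∷ [])

band-0+band-2 : ∀ k m x y →
  band k (4 * m) y + band k (4 * m + 2) x ≡ 2 + 4 * (2 * k + 1) * suc (2 * m) + (y + x)
band-0+band-2 k m x y = expanded
  where
  expanded : 2 * k + 2 + 4 * m * (2 * k + 1) + y + (2 * k + 2 + (4 * m + 2) * (2 * k + 1) + x)
           ≡ 2 + 4 * (2 * k + 1) * suc (2 * m) + (y + x)
  expanded = solve (k ∷ m ∷ x ∷ y ∷ [])

labU-pair : ∀ k n i m → i < 2 * k + 1 → m < n →
  labU k n (suc i) (suc (2 * m)) + labU k n (suc i) (2 + 2 * m) ≡ pairTotal k i (4 * k + 4) (n ∸ suc m)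
labU-pair k n i m i<K m<n with q , refl ← m≤n⇒∃[o]m+o≡n m<n =
  trans (cong₂ _+_ (labU-odd k m q i i<K) (labU-even k m q i i<K))
    (trans (band-3+band-1 k q _ _) (cong (pairTotal k i (4 * k + 4)) (sym (m+n∸m≡n m q))))

labV-pair : ∀ k n i m → i < 2 * k + 1 →
  labV k n (suc i) (suc (2 * m)) + labV k n (suc i) (2 + 2 * m) ≡ pairTotal k i 2 m
labV-pair k n i m i<K = trans (cong₂ _+_ (labV-odd k n m i i<K) (labV-even k n m i i<K)) (band-0+band-2 k m _ _)

rowTotal : ∀ k i c₀ n → i < 2 * k + 1 →
  suc i + Σ< (suc n) (pairTotal k i c₀)
  ≡ suc (3 * k) + (suc n * c₀ + 4 * (2 * k + 1) * (suc n * suc n) + n * (2 * k))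
rowTotal k i c₀ n i<K = begin
  suc i + Σ< (suc n) (pairTotal k i c₀)
    ≡⟨ cong (suc i +_) (Σ<-+ (suc n) (λ q → c₀ + B * suc (2 * q)) (λ q → R + pairOffset k q i)) ⟩
  suc i + (Σ< (suc n) (λ q → c₀ + B * suc (2 * q)) + (R + D + Σ< n (λ _ → R + F)))
    ≡⟨ cong₂ (λ x y → suc i + (x + (R + D + y))) (Σ<-odd (suc n) c₀ B) (Σ<-const n (R + F)) ⟩
  suc i + (A + (R + D + n * (R + F)))
    ≡⟨ regroup i A R D F n ⟩
  suc (i + (R + D)) + (A + n * (R + F))
    ≡⟨ cong₂ (λ x y → suc x + (A + n * y)) (i+rotate+double k i i<K) (rotate+reflect k i i<K) ⟩
  suc (3 * k) + (A + n * (2 * k)) ∎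
  where
  open ≡-Reasoning
  R D F B A : ℕ
  R = rotate k i
  D = double k i
  F = reflect k i
  B = 4 * (2 * k + 1)
  A = suc n * c₀ + B * (suc n * suc n)
  regroup : ∀ i A R D F n → suc i + (A + (R + D + n * (R + F))) ≡ suc (i + (R + D)) + (A + n * (R + F))
  regroup = solve-∀

rowSum-u : ∀ k n i → i < 2 * k + 1 → 1 ≤ n →
  suc i + Σ< (2 * n) (λ jj → labU k n (suc i) (suc jj)) ≡ uColour k n
rowSum-u k (suc n) i i<K _ = begin
  suc i + Σ< (2 * suc n) (λ jj → labU k (suc n) (suc i) (suc jj))
    ≡⟨ cong (suc i +_) (Σ<-pairs (suc n) (λ jj → labU k (suc n) (suc i) (suc jj))) ⟩
  suc i + Σ< (suc n) (λ m → labU k (suc n) (suc i) (suc (2 * m)) + labU k (suc n) (suc i) (2 + 2 * m))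
    ≡⟨ cong (suc i +_) (Σ<-cong (suc n) (λ m m<n → labU-pair k (suc n) i m i<K m<n)) ⟩
  suc i + Σ< (suc n) (λ m → pairTotal k i (4 * k + 4) (suc n ∸ suc m))
    ≡⟨ cong (suc i +_) (Σ<-reverse (suc n) (pairTotal k i (4 * k + 4))) ⟩
  suc i + Σ< (suc n) (pairTotal k i (4 * k + 4))
    ≡⟨ rowTotal k i (4 * k + 4) n i<K ⟩
  suc (3 * k) + (suc n * (4 * k + 4) + 4 * (2 * k + 1) * (suc n * suc n) + n * (2 * k))
    ≡⟨ closedForm ⟩
  uColour k (suc n) ∎
  where
  open ≡-Reasoning
  closedForm : suc (3 * k) + (suc n * (4 * k + 4) + 4 * (2 * k + 1) * (suc n * suc n) + n * (2 * k))
             ≡ 8 * suc n * suc n * k + 6 * suc n * k + 4 * suc n * suc n + 4 * suc n + k + 1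
  closedForm = solve (k ∷ n ∷ [])

rowSum-v : ∀ k n i → i < 2 * k + 1 → 1 ≤ n →
  suc i + Σ< (2 * n) (λ jj → labV k n (suc i) (suc jj)) ≡ vColour k n
rowSum-v k (suc n) i i<K _ = begin
  suc i + Σ< (2 * suc n) (λ jj → labV k (suc n) (suc i) (suc jj))
    ≡⟨ cong (suc i +_) (Σ<-pairs (suc n) (λ jj → labV k (suc n) (suc i) (suc jj))) ⟩
  suc i + Σ< (suc n) (λ m → labV k (suc n) (suc i) (suc (2 * m)) + labV k (suc n) (suc i) (2 + 2 * m))
    ≡⟨ cong (suc i +_) (Σ<-cong (suc n) (λ m _ → labV-pair k (suc n) i m i<K)) ⟩
  suc i + Σ< (suc n) (pairTotal k i 2)
    ≡⟨ rowTotal k i 2 n i<K ⟩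
  suc (3 * k) + (suc n * 2 + 4 * (2 * k + 1) * (suc n * suc n) + n * (2 * k))
    ≡⟨ closedForm ⟩
  vColour k (suc n) ∎
  where
  open ≡-Reasoning
  closedForm : suc (3 * k) + (suc n * 2 + 4 * (2 * k + 1) * (suc n * suc n) + n * (2 * k))
             ≡ 8 * suc n * suc n * k + 2 * suc n * k + 4 * suc n * suc n + 2 * suc n + k + 1
  closedForm = solve (k ∷ n ∷ [])

wUnit : ℕ → ℕ → ℕ
wUnit k n = (4 * k + 3) + n * (8 * k + 4)

wColour : ℕ → ℕ → ℕ → ℕ
wColour k n d = d * wUnit k n

uColour-between : ∀ k n → n * wUnit k n < uColour k n × uColour k n < suc n * wUnit k n
uColour-between k n =
  n≡1+m+o⇒m<n (2 * n * k + n + k) above , n≡1+m+o⇒m<n (3 * k + 1 + 6 * n * k + 3 * n) below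
  where
  above : 8 * n * n * k + 6 * n * k + 4 * n * n + 4 * n + k + 1
        ≡ suc (n * ((4 * k + 3) + n * (8 * k + 4)) + (2 * n * k + n + k))
  above = solve (k ∷ n ∷ [])
  below : suc n * ((4 * k + 3) + n * (8 * k + 4))
        ≡ suc (8 * n * n * k + 6 * n * k + 4 * n * n + 4 * n + k + 1 + (3 * k + 1 + 6 * n * k + 3 * n))
  below = solve (k ∷ n ∷ [])

vColour-between : ∀ k n →
  suc n * wUnit k (2 + n) < vColour k (2 + n) × vColour k (2 + n) < (2 + n) * wUnit k (2 + n)
vColour-between k n =
  n≡1+m+o⇒m<n (6 * (2 + n) * k + 3 * (2 + n) + 5 * k + 3) above , n≡1+m+o⇒m<n (3 * k + 2 * n * k + n) below
  where
  above : 8 * (2 + n) * (2 + n) * k + 2 * (2 + n) * k + 4 * (2 + n) * (2 + n) + 2 * (2 + n) + k + 1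
        ≡ suc (suc n * ((4 * k + 3) + (2 + n) * (8 * k + 4)) + (6 * (2 + n) * k + 3 * (2 + n) + 5 * k + 3))
  above = solve (k ∷ n ∷ [])
  below : (2 + n) * ((4 * k + 3) + (2 + n) * (8 * k + 4))
        ≡ suc (8 * (2 + n) * (2 + n) * k + 2 * (2 + n) * k + 4 * (2 + n) * (2 + n) + 2 * (2 + n) + k + 1
               + (3 * k + 2 * n * k + n))
  below = solve (k ∷ n ∷ [])

colours-distinct : ∀ k n d → 2 ≤ n →
  uColour k n ≢ vColour k n × uColour k n ≢ wColour k n d × vColour k n ≢ wColour k n d
colours-distinct k (suc zero)    d (s≤s ())
colours-distinct k (suc (suc n)) d _ =
  ≢-sym (<⇒≢ (<-trans v<nU (proj₁ (uColour-between k (2 + n))))) ,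
  between-multiples⇒≢ (2 + n) d (proj₁ (uColour-between k (2 + n))) (proj₂ (uColour-between k (2 + n))) ,
  between-multiples⇒≢ (suc n) d (proj₁ (vColour-between k n)) v<nU
  where
  v<nU : vColour k (2 + n) < (2 + n) * wUnit k (2 + n)
  v<nU = proj₂ (vColour-between k n)

-- Decoding labels

-- Row i of the edge list occupies the positions i(4n+1), …, i(4n+1) + 4n: first u_i v_i, then
-- u_i x_{i,jj+1} and v_i x_{i,jj+1} at uPos and vPos. decode sends each label to the position of its edge.
uPos vPos : (n i jj : ℕ) → ℕ
uPos n i jj = suc (i * (4 * n + 1)) + jj * 2
vPos n i jj = suc (uPos n i jj)

decodeBand : (k n Q s r : ℕ) → ℕ
decodeBand k n Q 0 r = vPos n (unrotate k r) (2 * Q)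
decodeBand k n Q 1 r = uPos n (unrotate k r) (suc (2 * (n ∸ suc Q)))
decodeBand k n Q 2 r = vPos n (unPairOffset k Q r) (suc (2 * Q))
decodeBand k n Q _ r = uPos n (unPairOffset k Q r) (2 * (n ∸ suc Q))

decode : (k n ℓ : ℕ) → ℕ
decode k n ℓ = if ℓ ≤ᵇ 2 * k + 1 then (ℓ ∸ 1) * (4 * n + 1) else decodeBand k n (c / 4) (c % 4) r
  where
  c r : ℕ
  c = (ℓ ∸ (2 * k + 2)) / suc (2 * k)
  r = (ℓ ∸ (2 * k + 2)) % suc (2 * k)

decode-band : ∀ k n Q s r → s < 4 → r < 2 * k + 1 → decode k n (band k (4 * Q + s) r) ≡ decodeBand k n Q s r
decode-band k n Q s r s<4 r<K = begin
  decode k n (band k (4 * Q + s) r)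
    ≡⟨ if-> (n≡1+m+o⇒m<n ((4 * Q + s) * (2 * k + 1) + r) aboveSmall) ⟩
  decodeBand k n (c / 4) (c % 4) ((band k (4 * Q + s) r ∸ (2 * k + 2)) % suc (2 * k))
    ≡⟨ cong₂ (λ c' r' → decodeBand k n (c' / 4) (c' % 4) r')
         (trans (cong (_/ suc (2 * k)) offset) ([m*n+r]/n≡m (4 * Q + s) (suc (2 * k)) r<1+2k))
         (trans (cong (_% suc (2 * k)) offset) ([m*n+r]%n≡r (4 * Q + s) (suc (2 * k)) r<1+2k)) ⟩
  decodeBand k n ((4 * Q + s) / 4) ((4 * Q + s) % 4) r
    ≡⟨ cong₂ (λ q' s' → decodeBand k n q' s' r)
         (trans (cong (λ x → (x + s) / 4) (*-comm 4 Q)) ([m*n+r]/n≡m Q 4 s<4))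
         (trans (cong (λ x → (x + s) % 4) (*-comm 4 Q)) ([m*n+r]%n≡r Q 4 s<4)) ⟩
  decodeBand k n Q s r ∎
  where
  open ≡-Reasoning
  c : ℕ
  c = (band k (4 * Q + s) r ∸ (2 * k + 2)) / suc (2 * k)
  r<1+2k : r < suc (2 * k)
  r<1+2k = subst (r <_) (+-comm (2 * k) 1) r<K
  aboveSmall : 2 * k + 2 + (4 * Q + s) * (2 * k + 1) + r ≡ suc (2 * k + 1 + ((4 * Q + s) * (2 * k + 1) + r))
  aboveSmall = solve (k ∷ Q ∷ s ∷ r ∷ [])
  offset : band k (4 * Q + s) r ∸ (2 * k + 2) ≡ (4 * Q + s) * suc (2 * k) + r
  offset = m≡n+o⇒m∸o≡n {2 * k + 2 + (4 * Q + s) * (2 * k + 1) + r} {2 * k + 2} _ (solve (k ∷ Q ∷ s ∷ r ∷ []))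

record Encodes (k n p ℓ : ℕ) : Set where
  field
    decodes  : decode k n ℓ ≡ p
    positive : 1 ≤ ℓ
    bounded  : ℓ ≤ (2 * k + 1) * (4 * n + 1)

band-positive : ∀ k c r → 1 ≤ band k c r
band-positive k c r = n≡1+m+o⇒m<n (2 * k + 1 + c * (2 * k + 1) + r) expanded
  where
  expanded : 2 * k + 2 + c * (2 * k + 1) + r ≡ suc (0 + (2 * k + 1 + c * (2 * k + 1) + r))
  expanded = solve (k ∷ c ∷ r ∷ [])

band-bounded : ∀ k n c r → c < 4 * n → r < 2 * k + 1 → band k c r ≤ (2 * k + 1) * (4 * n + 1)
band-bounded k n c r c<4n r<K = begin
  2 * k + 2 + c * (2 * k + 1) + r
    ≤⟨ +-monoʳ-≤ (2 * k + 2 + c * (2 * k + 1)) (s≤s⁻¹ (subst (r <_) (+-comm (2 * k) 1) r<K)) ⟩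
  2 * k + 2 + c * (2 * k + 1) + 2 * k
    ≡⟨ solve (k ∷ c ∷ []) ⟩
  (2 * k + 1) * (2 + c)
    ≤⟨ *-monoʳ-≤ (2 * k + 1) (subst (2 + c ≤_) (+-comm 1 (4 * n)) (s≤s c<4n)) ⟩
  (2 * k + 1) * (4 * n + 1) ∎
  where open ≤-Reasoning

4q+s<4n : ∀ {q s n} → s < 4 → q < n → 4 * q + s < 4 * n
4q+s<4n {q} s<4 q<n = <-≤-trans (+-monoʳ-< (4 * q) s<4)
  (≤-trans (≤-reflexive (trans (+-comm (4 * q) 4) (sym (*-suc 4 q)))) (*-monoʳ-≤ 4 q<n))

band-encodes : ∀ {k n p} Q s r → s < 4 → Q < n → r < 2 * k + 1 → decodeBand k n Q s r ≡ p →
  Encodes k n p (band k (4 * Q + s) r)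
band-encodes {k} {n} Q s r s<4 Q<n r<K decoded = record
  { decodes  = trans (decode-band k n Q s r s<4 r<K) decoded
  ; positive = band-positive k (4 * Q + s) r
  ; bounded  = band-bounded k n (4 * Q + s) r (4q+s<4n s<4 Q<n) r<K
  }

-- The 0-based index jj of x_{i,jj+1} as the first or second member of pair m, followed by q further pairs.
data PairView : ℕ → ℕ → Set where
  odd  : ∀ m q → PairView (suc (m + q)) (2 * m)
  even : ∀ m q → PairView (suc (m + q)) (suc (2 * m))

pairView : ∀ n jj → jj < 2 * n → PairView n jj
pairView (suc n) zero          _  = odd 0 n
pairView (suc n) (suc zero)    _  = even 0 n
pairView (suc n) (suc (suc jj)) jj<2n
  with pairView n jj (s≤s⁻¹ (s≤s⁻¹ (subst (suc (suc jj) <_) (*-suc 2 n) jj<2n)))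
... | odd  m q = subst (PairView _) (*-suc 2 m) (odd (suc m) q)
... | even m q = subst (PairView _) (cong suc (*-suc 2 m)) (even (suc m) q)

encodes-uv : ∀ k n i → i < 2 * k + 1 → Encodes k n (i * (4 * n + 1)) (suc i)
encodes-uv k n i i<K = record
  { decodes  = if-≤ i<K
  ; positive = s≤s z≤n
  ; bounded  = ≤-trans i<K
      (≤-trans (≤-reflexive (sym (*-identityʳ _))) (*-monoʳ-≤ (2 * k + 1) (m≤n+m 1 (4 * n))))
  }

encodes-u : ∀ k n i jj → i < 2 * k + 1 → jj < 2 * n → Encodes k n (uPos n i jj) (labU k n (suc i) (suc jj))
encodes-u k n i jj i<K jj<2n with pairView n jj jj<2n
... | odd m q = subst (Encodes k n (uPos n i (2 * m))) (sym (labU-odd k m q i i<K))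
  (band-encodes q 3 _ (s≤s (s≤s (s≤s (s≤s z≤n)))) (s≤s (m≤n+m q m)) (pairOffset-< k q i i<K)
    (cong₂ (λ i' m' → uPos (suc (m + q)) i' (2 * m')) (unPairOffset-pairOffset k q i i<K) (m+n∸n≡m m q)))
... | even m q = subst (Encodes k n (uPos n i (suc (2 * m)))) (sym (labU-even k m q i i<K))
  (band-encodes q 1 _ (s≤s (s≤s z≤n)) (s≤s (m≤n+m q m)) (rotate-< k i i<K)
    (cong₂ (λ i' m' → uPos (suc (m + q)) i' (suc (2 * m'))) (unrotate-rotate k i i<K) (m+n∸n≡m m q)))

encodes-v : ∀ k n i jj → i < 2 * k + 1 → jj < 2 * n → Encodes k n (vPos n i jj) (labV k n (suc i) (suc jj))
encodes-v k n i jj i<K jj<2n with pairView n jj jj<2n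
... | odd m q = subst (Encodes k n (vPos n i (2 * m))) (sym (labV-odd k n m i i<K))
  (subst (λ c → Encodes k n (vPos n i (2 * m)) (band k c (rotate k i))) (+-identityʳ (4 * m))
    (band-encodes m 0 _ (s≤s z≤n) (s≤s (m≤m+n m q)) (rotate-< k i i<K)
      (cong (λ i' → vPos (suc (m + q)) i' (2 * m)) (unrotate-rotate k i i<K))))
... | even m q = subst (Encodes k n (vPos n i (suc (2 * m)))) (sym (labV-even k n m i i<K))
  (band-encodes m 2 _ (s≤s (s≤s (s≤s z≤n))) (s≤s (m≤m+n m q)) (pairOffset-< k m i i<K)
    (cong (λ i' → vPos (suc (m + q)) i' (suc (2 * m))) (unPairOffset-pairOffset k m i i<K)))

-- The merged graph

module MergedGraph (n r s : ℕ) (blk : Blocks n r s) where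

  k K W N : ℕ
  k = kOf r s
  K = 2 * k + 1
  W = 2 * n * (2 * r + 1)
  N = K + (K + W)

  u v : Fin K → Fin N
  u i = i ↑ˡ (K + W)
  v i = K ↑ʳ (i ↑ˡ W)

  w : Fin (2 * n) → Fin (2 * r + 1) → Fin N
  w j b = K ↑ʳ (K ↑ʳ combine j b)

  spokes : Fin K → Fin (2 * n) → LabelledEdges N
  spokes i j = ((u i , w j (blk j i)) , labU k n (suc (toℕ i)) (suc (toℕ j)))
             ∷ ((v i , w j (blk j i)) , labV k n (suc (toℕ i)) (suc (toℕ j))) ∷ []

  row : Fin K → LabelledEdges N
  row i = ((u i , v i) , suc (toℕ i)) ∷ concat (tabulate (spokes i))

  Z : LabelledEdges N
  Z = concat (tabulate row)

  G : Graph
  G = graphOf N Z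

  mergedGraph≡G : mergedGraph n r s blk ≡ G
  mergedGraph≡G = cong (λ es → record { V = N ; edges = es }) (sym edges≡)
    where
    edges≡ : map proj₁ Z ≡ Graph.edges (mergedGraph n r s blk)
    edges≡ = trans (map-concat-tabulate proj₁ row)
      (concatMap-cong (λ i → cong ((u i , v i) ∷_) (map-concat-tabulate proj₁ (spokes i))) (allFin K))

  splitAt-u : ∀ i → splitAt K (u i) ≡ inj₁ i
  splitAt-u i = Fin.splitAt-↑ˡ K i (K + W)

  splitAt-vw : ∀ y → splitAt K (K ↑ʳ y) ≡ inj₂ y
  splitAt-vw y = Fin.splitAt-↑ʳ K (K + W) y

  u≢v : ∀ i i' → u i ≢ v i'
  u≢v i i' eq = inj₁≢inj₂ (trans (sym (splitAt-u i)) (trans (cong (splitAt K) eq) (splitAt-vw _)))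

  u≢w : ∀ i j b → u i ≢ w j b
  u≢w i j b eq = inj₁≢inj₂ (trans (sym (splitAt-u i)) (trans (cong (splitAt K) eq) (splitAt-vw _)))

  v≢w : ∀ i j b → v i ≢ w j b
  v≢w i j b eq = inj₁≢inj₂ (trans (sym (Fin.splitAt-↑ˡ K i W))
    (trans (cong (splitAt K) (Fin.↑ʳ-injective K _ _ eq)) (Fin.splitAt-↑ʳ K W (combine j b))))

  u-injective : ∀ {i i'} → u i ≡ u i' → i ≡ i'
  u-injective = Fin.↑ˡ-injective (K + W) _ _

  v-injective : ∀ {i i'} → v i ≡ v i' → i ≡ i'
  v-injective = Fin.↑ˡ-injective W _ _ ∘ Fin.↑ʳ-injective K _ _

  w-injective : ∀ {j b j' b'} → w j b ≡ w j' b' → j ≡ j' × b ≡ b'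
  w-injective = Fin.combine-injective _ _ _ _ ∘ Fin.↑ʳ-injective K _ _ ∘ Fin.↑ʳ-injective K _ _

  data Vertex : Fin N → Set where
    isU : ∀ i → Vertex (u i)
    isV : ∀ i → Vertex (v i)
    isW : ∀ j b → Vertex (w j b)

  vertex : ∀ x → Vertex x
  vertex x with splitAt K x in x≡
  ... | inj₁ i = subst Vertex (Fin.splitAt⁻¹-↑ˡ x≡) (isU i)
  ... | inj₂ y with splitAt K y in y≡
  ...   | inj₁ i = subst Vertex
          (trans (cong (K ↑ʳ_) (Fin.splitAt⁻¹-↑ˡ y≡)) (Fin.splitAt⁻¹-↑ʳ x≡))
          (isV i)
  ...   | inj₂ z = subst Vertex
          (trans (cong (λ t → K ↑ʳ (K ↑ʳ t)) (Fin.combine-remQuot {2 * n} (2 * r + 1) z))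
                 (trans (cong (K ↑ʳ_) (Fin.splitAt⁻¹-↑ʳ y≡)) (Fin.splitAt⁻¹-↑ʳ x≡)))
          (isW (proj₁ (remQuot {2 * n} (2 * r + 1) z)) (proj₂ (remQuot {2 * n} (2 * r + 1) z)))

  colour : Fin N → ℕ
  colour = inducedLabel G (labelOf Z)

  rowWeight : Fin N → Fin K → ℕ
  rowWeight x i = sum (map (weight x) (row i))

  colour≡Σrows : ∀ x → colour x ≡ sum (tabulate (rowWeight x))
  colour≡Σrows x = trans (inducedLabel-labelOf Z x) (sum-map-concat-tabulate (weight x) row)

  rowWeight≡spokes : ∀ x i → rowWeight x i
    ≡ weight x ((u i , v i) , suc (toℕ i)) + sum (tabulate (λ j → sum (map (weight x) (spokes i j))))
  rowWeight≡spokes x i =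
    cong (weight x ((u i , v i) , suc (toℕ i)) +_) (sum-map-concat-tabulate (weight x) (spokes i))

  colour-u : 1 ≤ n → ∀ i₀ → colour (u i₀) ≡ uColour k n
  colour-u 1≤n i₀ = begin
    colour (u i₀)                                               ≡⟨ colour≡Σrows (u i₀) ⟩
    sum (tabulate (rowWeight (u i₀)))                           ≡⟨ sum-tabulate-single _ i₀ otherRow ⟩
    rowWeight (u i₀) i₀                                         ≡⟨ rowWeight≡spokes (u i₀) i₀ ⟩
    weight (u i₀) ((u i₀ , v i₀) , suc (toℕ i₀)) + sum (tabulate (spokeWeight i₀))
      ≡⟨ cong₂ _+_ (weight-source (u i₀) (v i₀) _) (cong sum (tabulate-cong ownSpoke)) ⟩
    suc (toℕ i₀) + Σ< (2 * n) (λ jj → labU k n (suc (toℕ i₀)) (suc jj))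
      ≡⟨ rowSum-u k n (toℕ i₀) (Fin.toℕ<n i₀) 1≤n ⟩
    uColour k n                                                 ∎
    where
    open ≡-Reasoning
    spokeWeight : Fin K → Fin (2 * n) → ℕ
    spokeWeight i j = sum (map (weight (u i₀)) (spokes i j))
    ownSpoke : ∀ j → spokeWeight i₀ j ≡ labU k n (suc (toℕ i₀)) (suc (toℕ j))
    ownSpoke j = trans (cong₂ _+_ (weight-source (u i₀) (w j (blk j i₀)) _)
      (cong (_+ 0) (weight-elsewhere (v i₀) (w j (blk j i₀)) _ (≢-sym (u≢v i₀ i₀)) (≢-sym (u≢w i₀ j _)))))
      (+-identityʳ _)
    otherRow : ∀ i → i ≢ i₀ → rowWeight (u i₀) i ≡ 0
    otherRow i i≢i₀ = trans (rowWeight≡spokes (u i₀) i) (cong₂ _+_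
      (weight-elsewhere (u i) (v i) _ (i≢i₀ ∘ u-injective) (≢-sym (u≢v i₀ i)))
      (sum-tabulate-0 (spokeWeight i) λ j → cong₂ _+_
        (weight-elsewhere (u i) (w j (blk j i)) _ (i≢i₀ ∘ u-injective) (≢-sym (u≢w i₀ j _)))
        (cong (_+ 0) (weight-elsewhere (v i) (w j (blk j i)) _ (≢-sym (u≢v i₀ i)) (≢-sym (u≢w i₀ j _))))))

  colour-v : 1 ≤ n → ∀ i₀ → colour (v i₀) ≡ vColour k n
  colour-v 1≤n i₀ = begin
    colour (v i₀)                                               ≡⟨ colour≡Σrows (v i₀) ⟩
    sum (tabulate (rowWeight (v i₀)))                           ≡⟨ sum-tabulate-single _ i₀ otherRow ⟩
    rowWeight (v i₀) i₀                                         ≡⟨ rowWeight≡spokes (v i₀) i₀ ⟩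
    weight (v i₀) ((u i₀ , v i₀) , suc (toℕ i₀)) + sum (tabulate (spokeWeight i₀))
      ≡⟨ cong₂ _+_ (weight-target (u i₀) (v i₀) _) (cong sum (tabulate-cong ownSpoke)) ⟩
    suc (toℕ i₀) + Σ< (2 * n) (λ jj → labV k n (suc (toℕ i₀)) (suc jj))
      ≡⟨ rowSum-v k n (toℕ i₀) (Fin.toℕ<n i₀) 1≤n ⟩
    vColour k n                                                 ∎
    where
    open ≡-Reasoning
    spokeWeight : Fin K → Fin (2 * n) → ℕ
    spokeWeight i j = sum (map (weight (v i₀)) (spokes i j))
    ownSpoke : ∀ j → spokeWeight i₀ j ≡ labV k n (suc (toℕ i₀)) (suc (toℕ j))
    ownSpoke j = cong₂ _+_ (weight-elsewhere (u i₀) (w j (blk j i₀)) _ (u≢v i₀ i₀) (≢-sym (v≢w i₀ j _)))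
      (trans (cong (_+ 0) (weight-source (v i₀) (w j (blk j i₀)) _)) (+-identityʳ _))
    otherRow : ∀ i → i ≢ i₀ → rowWeight (v i₀) i ≡ 0
    otherRow i i≢i₀ = trans (rowWeight≡spokes (v i₀) i) (cong₂ _+_
      (weight-elsewhere (u i) (v i) _ (u≢v i i₀) (i≢i₀ ∘ v-injective))
      (sum-tabulate-0 (spokeWeight i) λ j → cong₂ _+_
        (weight-elsewhere (u i) (w j (blk j i)) _ (u≢v i i₀) (≢-sym (v≢w i₀ j _)))
        (cong (_+ 0) (weight-elsewhere (v i) (w j (blk j i)) _ (i≢i₀ ∘ v-injective) (≢-sym (v≢w i₀ j _))))))

  colour-w : ValidBlocks n r s blk → ∀ j₀ b₀ → colour (w j₀ b₀) ≡ wColour k n (2 * s + 1)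
  colour-w valid j₀ b₀ = begin
    colour (w j₀ b₀)                           ≡⟨ colour≡Σrows (w j₀ b₀) ⟩
    sum (tabulate (rowWeight (w j₀ b₀)))       ≡⟨ cong sum (tabulate-cong inBlock) ⟩
    sum (tabulate selected)                    ≡⟨ cong sum (map-tabulate (λ i → i) selected) ⟨
    sum (map selected (allFin K))              ≡⟨ sum-map-filter inBlock? labelSum (allFin K) ⟨
    sum (map labelSum (filter inBlock? (allFin K))) ≡⟨ ValidBlocks.bsum valid j₀ b₀ ⟩
    wColour k n (2 * s + 1)                    ∎
    where
    open ≡-Reasoning
    inBlock? : ∀ i → Dec (blk j₀ i ≡ b₀)
    inBlock? i = blk j₀ i Fin.≟ b₀
    labelSum selected : Fin K → ℕ
    labelSum i = labX k n (suc (toℕ i)) (suc (toℕ j₀))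
    selected i = if does (inBlock? i) then labelSum i else 0
    ownSpoke : ∀ i → sum (map (weight (w j₀ b₀)) (spokes i j₀)) ≡ selected i
    ownSpoke i with inBlock? i
    ... | yes e rewrite e = cong₂ _+_ (weight-target (u i) (w j₀ b₀) _)
                              (trans (cong (_+ 0) (weight-target (v i) (w j₀ b₀) _)) (+-identityʳ _))
    ... | no e = cong₂ _+_
      (weight-elsewhere (u i) (w j₀ (blk j₀ i)) _ (u≢w i j₀ b₀) (e ∘ proj₂ ∘ w-injective))
      (cong (_+ 0) (weight-elsewhere (v i) (w j₀ (blk j₀ i)) _ (v≢w i j₀ b₀) (e ∘ proj₂ ∘ w-injective)))
    otherSpoke : ∀ i j → j ≢ j₀ → sum (map (weight (w j₀ b₀)) (spokes i j)) ≡ 0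
    otherSpoke i j j≢j₀ =
      cong₂ _+_ (weight-elsewhere (u i) (w j (blk j i)) _ (u≢w i j₀ b₀) (j≢j₀ ∘ proj₁ ∘ w-injective))
        (cong (_+ 0) (weight-elsewhere (v i) (w j (blk j i)) _ (v≢w i j₀ b₀) (j≢j₀ ∘ proj₁ ∘ w-injective)))
    inBlock : ∀ i → rowWeight (w j₀ b₀) i ≡ selected i
    inBlock i = trans (rowWeight≡spokes (w j₀ b₀) i)
      (cong₂ _+_ (weight-elsewhere (u i) (v i) _ (u≢w i j₀ b₀) (v≢w i j₀ b₀))
        (trans (sum-tabulate-single _ j₀ (otherSpoke i)) (ownSpoke i)))

  rowLength : ∀ i → length (row i) ≡ 4 * n + 1
  rowLength i = trans (cong suc (length-concat-tabulate 2 (spokes i) (λ _ → refl))) (1+2n*2≡4n+1 n)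
    where
    1+2n*2≡4n+1 : ∀ n → suc (2 * n * 2) ≡ 4 * n + 1
    1+2n*2≡4n+1 = solve-∀

  encoded : AllAt (λ p z → Encodes k n p (proj₂ z)) 0 Z
  encoded = AllAt-concat 0 (4 * n + 1) row rowLength λ i →
      encodes-uv k n (toℕ i) (Fin.toℕ<n i)
    , AllAt-concat (suc (toℕ i * (4 * n + 1))) 2 (spokes i) (λ _ → refl) λ j →
        encodes-u k n (toℕ i) (toℕ j) (Fin.toℕ<n i) (Fin.toℕ<n j) ,
        encodes-v k n (toℕ i) (toℕ j) (Fin.toℕ<n i) (Fin.toℕ<n j) , tt

  labelOf-encodes : ∀ e → Encodes k n (toℕ e) (labelOf Z e)
  labelOf-encodes = AllAt-labelOf 0 Z encoded

  edgeCount : nE G ≡ K * (4 * n + 1)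
  edgeCount = trans (length-map proj₁ Z) (length-concat-tabulate (4 * n + 1) row rowLength)

  triangle : ∀ i j →
    (u i , v i) ∈ Graph.edges G × (u i , w j (blk j i)) ∈ Graph.edges G × (v i , w j (blk j i)) ∈ Graph.edges G
  triangle i j = ∈-map⁺ proj₁ (∈-concat⁺′ (here refl) (∈-tabulate⁺ i))
    , ∈-map⁺ proj₁ (∈-concat⁺′ (there (∈-concat⁺′ (here refl) (∈-tabulate⁺ j))) (∈-tabulate⁺ i))
    , ∈-map⁺ proj₁ (∈-concat⁺′ (there (∈-concat⁺′ (there (here refl)) (∈-tabulate⁺ j))) (∈-tabulate⁺ i))

  module _ (2≤n : 2 ≤ n) (valid : ValidBlocks n r s blk) where

    1≤n : 1 ≤ n
    1≤n = ≤-trans (s≤s z≤n) 2≤n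

    palette : List ℕ
    palette = uColour k n ∷ vColour k n ∷ wColour k n (2 * s + 1) ∷ []

    coloured : ∀ x → colour x ∈ palette
    coloured x with vertex x
    ... | isU i   = subst (_∈ palette) (sym (colour-u 1≤n i)) (here refl)
    ... | isV i   = subst (_∈ palette) (sym (colour-v 1≤n i)) (there (here refl))
    ... | isW j b = subst (_∈ palette) (sym (colour-w valid j b)) (there (there (here refl)))

    proper : All.All (λ e → colour (proj₁ e) ≢ colour (proj₂ e)) (Graph.edges G)
    proper = Allₚ.map⁺ (Allₚ.concat⁺ (Allₚ.tabulate⁺ λ i →
      separated (colour-u 1≤n i) (colour-v 1≤n i) (proj₁ distinct) ∷
      Allₚ.concat⁺ (Allₚ.tabulate⁺ λ j →
        separated (colour-u 1≤n i) (colour-w valid j _) (proj₁ (proj₂ distinct)) ∷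
        separated (colour-v 1≤n i) (colour-w valid j _) (proj₂ (proj₂ distinct)) ∷ [])))
      where
      open All using ([]; _∷_)
      distinct : uColour k n ≢ vColour k n × uColour k n ≢ wColour k n (2 * s + 1)
               × vColour k n ≢ wColour k n (2 * s + 1)
      distinct = colours-distinct k n (2 * s + 1) 2≤n
      separated : ∀ {x y c d} → colour x ≡ c → colour y ≡ d → c ≢ d → colour x ≢ colour y
      separated x≡c y≡d c≢d eq = c≢d (trans (sym x≡c) (trans eq y≡d))

    antimagic : LocalAntimagic G (labelOf Z)
    antimagic = record
      { range     = λ e → Encodes.positive (labelOf-encodes e)
                        , subst (labelOf Z e ≤_) (sym edgeCount) (Encodes.bounded (labelOf-encodes e))
      ; injective = λ {e} {e′} eq → Fin.toℕ-injective (trans (sym (Encodes.decodes (labelOf-encodes e)))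
                      (trans (cong (decode k n) eq) (Encodes.decodes (labelOf-encodes e′))))
      ; proper    = λ e → All.lookup proper (∈-lookup e)
      }

    i₀ : Fin K
    i₀ = Fin.fromℕ< (m≤n+m 1 (2 * k))

    j₀ : Fin (2 * n)
    j₀ = Fin.fromℕ< (≤-trans 1≤n (m≤m+n n (n + 0)))

    atLeastThree : ∀ g → LocalAntimagic G g → 3 ≤ numColours G g
    atLeastThree g antimagic′ =
      let (uv , uw , vw) = triangle i₀ j₀ in triangle⇒3≤numColours G g antimagic′ uv uw vw

    χla≡3 : ChiLaEq G 3
    χla≡3 = (labelOf Z , antimagic , exactlyThree) , atLeastThree
      where
      exactlyThree : numColours G (labelOf Z) ≡ 3
      exactlyThree = ≤-antisym (numColours≤ G (labelOf Z) palette coloured) (atLeastThree (labelOf Z) antimagic)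

theorem2p4 : ∀ (n r s : ℕ) → 2 ≤ n → 1 ≤ r → 1 ≤ s →
    (blk : Blocks n r s) → ValidBlocks n r s blk →
    ChiLaEq (mergedGraph n r s blk) 3
theorem2p4 n r s 2≤n _ _ blk valid = subst (λ H → ChiLaEq H 3) (sym mergedGraph≡G) (χla≡3 2≤n valid)
  where open MergedGraph n r s blk
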